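{- Let $r\geq 1$ and $k\geq 0$ be integers. For each integer $n\geq 0$, let $N(n,r,k)$ denote the number of binary words of length $n$ which (if $n>0$) begin with the symbol $0$ and which contain exactly $k$ maximal runs of length exactly $r$. Then, as formal power series in $x$, $$\sum_{n=0}^{\infty}N(n,r,k)\,x^n=x^{kr}\left(\frac{1-x}{1-2x+x^r-x^{r+1}}\right)^{k+1}.$$
   Context: A binary word is a finite sequence of symbols from $\{0,1\}$. A maximal run (or simply run) in a binary word is a maximal consecutive subword consisting of identical symbols; equivalently, cutting the word between every pair of consecutive differing symbols yields its runs. The length of a run is its number of symbols. For $n=0$ the only word counted is the empty word, which has no runs (so $N(0,r,0)=1$ and $N(0,r,k)=0$ for $k>0$). -}

module Defs where

open import Data.Bool using (Bool; true; false; not; if_then_else_; _∧_)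
open import Data.Nat as ℕ using (ℕ; zero; suc; _∸_; _≡ᵇ_; _≤ᵇ_)
open import Data.Integer as ℤ using (ℤ; +_; -_)
open import Data.List using (List; []; _∷_; map; _++_; length; filterᵇ)

-- Binary words, maximal runs, and the count N(n,r,k)
-- A binary word is a List Bool; the symbol 0 is `false`, 1 is `true`.

words : ℕ → List (List Bool)
words zero    = [] ∷ []
words (suc n) = map (false ∷_) (words n) ++ map (true ∷_) (words n)

sameSym : Bool → Bool → Bool
sameSym b b' = if b then b' else not b'

-- lengths of the maximal runs of a word, from left to right
-- (go b c w : the current run consists of symbol b and has length c so far)
runsFrom : Bool → ℕ → List Bool → List ℕ
runsFrom b c []       = c ∷ []
runsFrom b c (b' ∷ w) = if sameSym b b' then runsFrom b (suc c) w
                                        else c ∷ runsFrom b' 1 w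

runLengths : List Bool → List ℕ
runLengths []      = []
runLengths (b ∷ w) = runsFrom b 1 w

runsOfLength : ℕ → List Bool → ℕ
runsOfLength r w = length (filterᵇ (λ c → c ≡ᵇ r) (runLengths w))

beginsWith0 : List Bool → Bool
beginsWith0 []      = true
beginsWith0 (b ∷ _) = not b

N : ℕ → ℕ → ℕ → ℕ
N n r k = length (filterᵇ (λ w → beginsWith0 w ∧ (runsOfLength r w ≡ᵇ k)) (words n))

PS : Set
PS = ℕ → ℤ

sumTo : (ℕ → ℤ) → ℕ → ℤ
sumTo h zero    = h zero
sumTo h (suc n) = sumTo h n ℤ.+ h (suc n)

_⊕_ : PS → PS → PS
(f ⊕ g) n = f n ℤ.+ g n

⊖_ : PS → PS
(⊖ f) n = - f n

_⊗_ : PS → PS → PS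
(f ⊗ g) n = sumTo (λ i → f i ℤ.* g (n ∸ i)) n

_·_ : ℤ → PS → PS
(c · f) n = c ℤ.* f n

X^ : ℕ → PS
X^ m n = if m ≡ᵇ n then + 1 else + 0

one : PS
one = X^ 0

_^ps_ : PS → ℕ → PS
f ^ps zero  = one
f ^ps suc m = f ⊗ (f ^ps m)

-- Multiplicative inverse of a power series f with constant term 1
-- (the usual recursion  b₀ = 1,  b_{m} = - Σ_{i=1}^{m} f_i b_{m-i}).
-- invTab n j = b_j for j ≤ n.
invTab : PS → ℕ → ℕ → ℤ
invTab f zero    j = + 1
invTab f (suc n) j = if j ≤ᵇ n then invTab f n j
                     else - sumTo (λ i → f (suc i) ℤ.* invTab f n (n ∸ i)) n

inv1 : PS → PS
inv1 f n = invTab f n n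

numer : PS
numer = one ⊕ (⊖ X^ 1)

-- 1 - 2x + x^r - x^(r+1)   (constant term 1 whenever r ≥ 1)
denom : ℕ → PS
denom r = ((one ⊕ (⊖ ((+ 2) · X^ 1))) ⊕ X^ r) ⊕ (⊖ X^ (suc r))

GF : ℕ → ℕ → PS
GF r k n = + N n r k

RHS : ℕ → ℕ → PS
RHS r k = X^ (k ℕ.* r) ⊗ ((numer ⊗ inv1 (denom r)) ^ps suc k)

-- Read a word from left to right, remembering only the length c of its current run. Let B c be the
-- generating function of the words w for which a run of length c followed by w has k runs of
-- length r. Since w either extends the current run or closes it, and what follows a closed run is
-- counted like a word beginning with 0, B c = x·B (c+1) + a_k with a_k = Σ N(n,r,k) xⁿ, except that
-- a_{k−1} replaces a_k when c = r; and B c no longer depends on c once c > r. Eliminating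
-- B 1, …, B (r+1) from this linear system gives
--   (1 − 2x + x^r − x^{r+1}) a_k = (1 − x)(δ_{k0} + x^r a_{k−1}).
-- For r ≥ 1 the denominator has constant term 1, hence is invertible, and induction on k yields
-- the closed form.

module Submission where

open import Defs
open import Data.Nat using (ℕ; _≤_)
open import Data.List using (List; []; _∷_; map; _++_; length; filterᵇ)
open import Relation.Binary.PropositionalEquality using (_≡_)

open import Algebra.Bundles using (CommutativeRing)
open import Algebra.Structures using (IsAbelianGroup)
import Algebra.Construct.Pointwise as Pointwise
open import Algebra.Consequences.Setoid using (comm∧idˡ⇒id; comm∧distrʳ⇒distr)
open import Algebra.Solver.Ring.AlmostCommutativeRing
  using (fromCommutativeRing; _-Raw-AlmostCommutative⟶_)
open import Data.Bool using (Bool; true; false; if_then_else_; _∧_)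
open import Data.Empty using (⊥-elim)
open import Data.Integer as ℤ using (ℤ; +_; -_; +0)
import Data.Integer.Properties as ℤₚ
open import Data.Integer.Tactic.RingSolver using (solve-∀)
open import Data.Maybe using (Maybe; just; nothing)
open import Data.Nat as ℕ using (zero; suc; _∸_; _≡ᵇ_; _≤ᵇ_; s≤s)
import Data.Nat.Properties as ℕₚ
open import Data.Sum using (inj₁; inj₂)
open import Function using (_∘_)
open import Level using (0ℓ)
open import Relation.Binary.PropositionalEquality
  using (_≗_; _≢_; refl; sym; trans; cong; cong₂; subst; module ≡-Reasoning)
open import Relation.Nullary using (yes; no)

-- Power series over ℤ form a commutative ring

0ₚ : PS
0ₚ _ = +0

tail : PS → PS
tail f n = f (suc n)

sumTo-cong : ∀ {g h : ℕ → ℤ} → g ≗ h → sumTo g ≗ sumTo h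
sumTo-cong g≗h zero    = g≗h 0
sumTo-cong g≗h (suc n) = cong₂ ℤ._+_ (sumTo-cong g≗h n) (g≗h (suc n))

sumTo-suc : ∀ h n → sumTo h (suc n) ≡ h 0 ℤ.+ sumTo (h ∘ suc) n
sumTo-suc h zero    = refl
sumTo-suc h (suc n) =
  trans (cong (ℤ._+ h (suc (suc n))) (sumTo-suc h n)) (ℤₚ.+-assoc (h 0) _ _)

sumTo-+ : ∀ g h n → sumTo (λ i → g i ℤ.+ h i) n ≡ sumTo g n ℤ.+ sumTo h n
sumTo-+ g h zero    = refl
sumTo-+ g h (suc n) =
  trans (cong (ℤ._+ (g (suc n) ℤ.+ h (suc n))) (sumTo-+ g h n))
        (interchange (sumTo g n) (sumTo h n) (g (suc n)) (h (suc n)))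
  where
  interchange : ∀ a b c d → (a ℤ.+ b) ℤ.+ (c ℤ.+ d) ≡ (a ℤ.+ c) ℤ.+ (b ℤ.+ d)
  interchange = solve-∀

sumTo-*ˡ : ∀ c h n → sumTo (λ i → c ℤ.* h i) n ≡ c ℤ.* sumTo h n
sumTo-*ˡ c h zero    = refl
sumTo-*ˡ c h (suc n) =
  trans (cong (ℤ._+ (c ℤ.* h (suc n))) (sumTo-*ˡ c h n)) (sym (ℤₚ.*-distribˡ-+ c _ _))

sumTo-zero : sumTo 0ₚ ≗ 0ₚ
sumTo-zero zero    = refl
sumTo-zero (suc n) = cong (ℤ._+ +0) (sumTo-zero n)

tail-⊗ : ∀ f g → tail (f ⊗ g) ≗ (f 0 · tail g) ⊕ (tail f ⊗ g)
tail-⊗ f g n = sumTo-suc (λ i → f i ℤ.* g (suc n ∸ i)) n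

⊗-cong : ∀ {f f′ g g′} → f ≗ f′ → g ≗ g′ → f ⊗ g ≗ f′ ⊗ g′
⊗-cong f≗f′ g≗g′ n = sumTo-cong (λ i → cong₂ ℤ._*_ (f≗f′ i) (g≗g′ (n ∸ i))) n

-- The congruences take the fixed factor explicitly: Agda cannot infer it through the pointwise
-- equality, which unfolds the convolution.
⊗-congˡ : ∀ f {g h} → g ≗ h → f ⊗ g ≗ f ⊗ h
⊗-congˡ f = ⊗-cong {f} {f} (λ _ → refl)

⊗-congʳ : ∀ h {f g} → f ≗ g → f ⊗ h ≗ g ⊗ h
⊗-congʳ h f≗g = ⊗-cong {g = h} {h} f≗g (λ _ → refl)

⊕-congˡ : ∀ f {g h} → g ≗ h → f ⊕ g ≗ f ⊕ h
⊕-congˡ f g≗h n = cong (ℤ._+_ (f n)) (g≗h n)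

⊕-congʳ : ∀ h {f g} → f ≗ g → f ⊕ h ≗ g ⊕ h
⊕-congʳ h f≗g n = cong (ℤ._+ h n) (f≗g n)

⊗-zeroˡ : ∀ g → 0ₚ ⊗ g ≗ 0ₚ
⊗-zeroˡ g n = trans (sumTo-cong (λ i → ℤₚ.*-zeroˡ (g (n ∸ i))) n) (sumTo-zero n)

⊗-distribʳ : ∀ h f g → (f ⊕ g) ⊗ h ≗ (f ⊗ h) ⊕ (g ⊗ h)
⊗-distribʳ h f g n =
  trans (sumTo-cong (λ i → ℤₚ.*-distribʳ-+ (h (n ∸ i)) (f i) (g i)) n) (sumTo-+ _ _ n)

·-⊗ : ∀ c f g → (c · f) ⊗ g ≗ c · (f ⊗ g)
·-⊗ c f g n = trans (sumTo-cong (λ i → ℤₚ.*-assoc c (f i) (g (n ∸ i))) n) (sumTo-*ˡ c _ n)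

⊗-identityˡ : ∀ g → one ⊗ g ≗ g
⊗-identityˡ g zero    = ℤₚ.*-identityˡ (g 0)
⊗-identityˡ g (suc n) = begin
  (one ⊗ g) (suc n)                       ≡⟨ tail-⊗ one g n ⟩
  + 1 ℤ.* g (suc n) ℤ.+ (0ₚ ⊗ g) n  ≡⟨ cong₂ ℤ._+_ (ℤₚ.*-identityˡ (g (suc n))) (⊗-zeroˡ g n) ⟩
  g (suc n) ℤ.+ +0                        ≡⟨ ℤₚ.+-identityʳ _ ⟩
  g (suc n)                               ∎
  where open ≡-Reasoning

⊗-assoc : ∀ f g h → (f ⊗ g) ⊗ h ≗ f ⊗ (g ⊗ h)
⊗-assoc f g h zero    = ℤₚ.*-assoc (f 0) (g 0) (h 0)
⊗-assoc f g h (suc n) = begin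
  ((f ⊗ g) ⊗ h) (suc n)
    ≡⟨ tail-⊗ (f ⊗ g) h n ⟩
  f 0 ℤ.* g 0 ℤ.* h (suc n) ℤ.+ (tail (f ⊗ g) ⊗ h) n
    ≡⟨ cong (ℤ._+_ (f 0 ℤ.* g 0 ℤ.* h (suc n))) tail-assoc ⟩
  f 0 ℤ.* g 0 ℤ.* h (suc n) ℤ.+ (f 0 ℤ.* (tail g ⊗ h) n ℤ.+ (tail f ⊗ (g ⊗ h)) n)
    ≡⟨ regroup (f 0) (g 0) (h (suc n)) _ _ ⟩
  f 0 ℤ.* (g 0 ℤ.* h (suc n) ℤ.+ (tail g ⊗ h) n) ℤ.+ (tail f ⊗ (g ⊗ h)) n
    ≡⟨ cong (λ t → f 0 ℤ.* t ℤ.+ (tail f ⊗ (g ⊗ h)) n) (sym (tail-⊗ g h n)) ⟩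
  f 0 ℤ.* (g ⊗ h) (suc n) ℤ.+ (tail f ⊗ (g ⊗ h)) n
    ≡⟨ sym (tail-⊗ f (g ⊗ h) n) ⟩
  (f ⊗ (g ⊗ h)) (suc n) ∎
  where
  open ≡-Reasoning
  regroup : ∀ a b c t u → a ℤ.* b ℤ.* c ℤ.+ (a ℤ.* t ℤ.+ u) ≡ a ℤ.* (b ℤ.* c ℤ.+ t) ℤ.+ u
  regroup = solve-∀
  tail-assoc : (tail (f ⊗ g) ⊗ h) n ≡ f 0 ℤ.* (tail g ⊗ h) n ℤ.+ (tail f ⊗ (g ⊗ h)) n
  tail-assoc = begin
    (tail (f ⊗ g) ⊗ h) n                          ≡⟨ ⊗-congʳ h (tail-⊗ f g) n ⟩
    (((f 0 · tail g) ⊕ (tail f ⊗ g)) ⊗ h) n        ≡⟨ ⊗-distribʳ h (f 0 · tail g) (tail f ⊗ g) n ⟩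
    ((f 0 · tail g) ⊗ h) n ℤ.+ ((tail f ⊗ g) ⊗ h) n ≡⟨ cong₂ ℤ._+_ (·-⊗ (f 0) (tail g) h n)
                                                                   (⊗-assoc (tail f) g h n) ⟩
    f 0 ℤ.* (tail g ⊗ h) n ℤ.+ (tail f ⊗ (g ⊗ h)) n ∎

-- Two steps of tail-⊗ expose both leading terms, leaving (tail f ⊗ tail g) two places lower.
⊗-comm : ∀ f g → f ⊗ g ≗ g ⊗ f
⊗-comm f g zero          = ℤₚ.*-comm (f 0) (g 0)
⊗-comm f g (suc zero)    = swap (f 0) (g 0) (f 1) (g 1)
  where
  swap : ∀ a b c d → a ℤ.* d ℤ.+ c ℤ.* b ≡ b ℤ.* c ℤ.+ d ℤ.* a
  swap = solve-∀
⊗-comm f g (suc (suc m)) = begin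
  (f ⊗ g) (suc (suc m))               ≡⟨ tail-⊗ f g (suc m) ⟩
  a ℤ.+ (tail f ⊗ g) (suc m)          ≡⟨ cong (ℤ._+_ a) (⊗-comm (tail f) g (suc m)) ⟩
  a ℤ.+ (g ⊗ tail f) (suc m)          ≡⟨ cong (ℤ._+_ a) (tail-⊗ g (tail f) m) ⟩
  a ℤ.+ (b ℤ.+ (tail g ⊗ tail f) m)   ≡⟨ swap a b _ ⟩
  b ℤ.+ (a ℤ.+ (tail g ⊗ tail f) m)   ≡⟨ cong (λ t → b ℤ.+ (a ℤ.+ t)) (⊗-comm (tail g) (tail f) m) ⟩
  b ℤ.+ (a ℤ.+ (tail f ⊗ tail g) m)   ≡⟨ cong (ℤ._+_ b) (sym (tail-⊗ f (tail g) m)) ⟩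
  b ℤ.+ (f ⊗ tail g) (suc m)          ≡⟨ cong (ℤ._+_ b) (⊗-comm f (tail g) (suc m)) ⟩
  b ℤ.+ (tail g ⊗ f) (suc m)          ≡⟨ sym (tail-⊗ g f (suc m)) ⟩
  (g ⊗ f) (suc (suc m))               ∎
  where
  open ≡-Reasoning
  a b : ℤ
  a = f 0 ℤ.* g (suc (suc m))
  b = g 0 ℤ.* f (suc (suc m))
  swap : ∀ a b t → a ℤ.+ (b ℤ.+ t) ≡ b ℤ.+ (a ℤ.+ t)
  swap = solve-∀

+-isAbelianGroup : IsAbelianGroup _≗_ _⊕_ 0ₚ ⊖_
+-isAbelianGroup = Pointwise.isAbelianGroup ℕ ℤₚ.+-0-isAbelianGroup

PS-commutativeRing : CommutativeRing 0ℓ 0ℓ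
PS-commutativeRing = record
  { Carrier           = PS
  ; _≈_               = _≗_
  ; _+_               = _⊕_
  ; _*_               = _⊗_
  ; -_                = ⊖_
  ; 0#                = 0ₚ
  ; 1#                = one
  ; isCommutativeRing = record
    { isRing = record
      { +-isAbelianGroup = +-isAbelianGroup
      ; *-cong           = ⊗-cong
      ; *-assoc          = ⊗-assoc
      ; *-identity       = comm∧idˡ⇒id setoid ⊗-comm {one} ⊗-identityˡ
      ; distrib          = comm∧distrʳ⇒distr setoid ∙-cong ⊗-comm ⊗-distribʳ
      }
    ; *-comm = ⊗-comm
    }
  }
  where open IsAbelianGroup +-isAbelianGroup using (setoid; ∙-cong)

module PS = CommutativeRing PS-commutativeRing
import Relation.Binary.Reasoning.Setoid PS.setoid as ≈-Reasoning
open import Algebra.Properties.CommutativeSemigroup PS.*-commutativeSemigroup using (x∙yz≈y∙xz)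

-- Chosen so that constant (+ 1) is definitionally one: the solver's con (+ 1) then stands for one.
constant : ℤ → PS
constant c n = if 0 ≡ᵇ n then c else +0

constant-⊗ : ∀ c f → constant c ⊗ f ≗ c · f
constant-⊗ c f zero    = refl
constant-⊗ c f (suc n) =
  trans (tail-⊗ (constant c) f n)
        (trans (cong (ℤ._+_ (c ℤ.* f (suc n))) (⊗-zeroˡ f n)) (ℤₚ.+-identityʳ _))

constant-morphism : ℤ.+-*-rawRing -Raw-AlmostCommutative⟶ fromCommutativeRing PS-commutativeRing
constant-morphism = record
  { ⟦_⟧    = constant
  ; +-homo = λ a b → λ { zero → refl ; (suc n) → refl }
  ; *-homo = λ a b → PS.sym (PS.trans (constant-⊗ a (constant b)) (scaled a b))
  ; -‿homo = λ a → λ { zero → refl ; (suc n) → refl }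
  ; 0-homo = λ { zero → refl ; (suc n) → refl }
  ; 1-homo = λ _ → refl
  }
  where
  scaled : ∀ a b → a · constant b ≗ constant (a ℤ.* b)
  scaled a b zero    = refl
  scaled a b (suc n) = ℤₚ.*-zeroʳ a

constant-≟ : ∀ a b → Maybe (constant a ≗ constant b)
constant-≟ a b with a ℤ.≟ b
... | yes refl = just (λ _ → refl)
... | no _     = nothing

open import Algebra.Solver.Ring ℤ.+-*-rawRing (fromCommutativeRing PS-commutativeRing)
  constant-morphism constant-≟
  using (solve; _:=_; con; _:+_; _:*_; _:-_; :-_)

X : PS
X = X^ 1

shift : PS → PS
shift f zero    = +0
shift f (suc n) = f n

X⊗-shift : ∀ f → X ⊗ f ≗ shift f
X⊗-shift f zero    = ℤₚ.*-zeroˡ (f 0)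
X⊗-shift f (suc n) = begin
  (X ⊗ f) (suc n)                   ≡⟨ tail-⊗ X f n ⟩
  +0 ℤ.* f (suc n) ℤ.+ (one ⊗ f) n  ≡⟨ cong₂ ℤ._+_ (ℤₚ.*-zeroˡ (f (suc n))) (⊗-identityˡ f n) ⟩
  +0 ℤ.+ f n                        ≡⟨ ℤₚ.+-identityˡ (f n) ⟩
  f n                               ∎
  where open ≡-Reasoning

X^-suc : ∀ m → X^ (suc m) ≗ X ⊗ X^ m
X^-suc m = PS.sym (PS.trans (X⊗-shift (X^ m)) λ { zero → refl ; (suc n) → refl })

X^-+ : ∀ m n → X^ (m ℕ.+ n) ≗ X^ m ⊗ X^ n
X^-+ zero    n = PS.sym (PS.*-identityˡ (X^ n))
X^-+ (suc m) n = begin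
  X^ (suc m ℕ.+ n)    ≈⟨ X^-suc (m ℕ.+ n) ⟩
  X ⊗ X^ (m ℕ.+ n)    ≈⟨ ⊗-congˡ X (X^-+ m n) ⟩
  X ⊗ (X^ m ⊗ X^ n)   ≈⟨ PS.*-assoc X (X^ m) (X^ n) ⟨
  (X ⊗ X^ m) ⊗ X^ n   ≈⟨ ⊗-congʳ (X^ n) (X^-suc m) ⟨
  X^ (suc m) ⊗ X^ n   ∎
  where open ≈-Reasoning

invTab-stable : ∀ f {m j} → j ℕ.≤ m → invTab f m j ≡ inv1 f j
invTab-stable f {zero}  ℕ.z≤n = refl
invTab-stable f {suc m} {j} j≤1+m with ℕₚ.m≤n⇒m<n∨m≡n j≤1+m
... | inj₂ refl         = refl
... | inj₁ (s≤s j≤m) with j ≤ᵇ m | ℕₚ.≤⇒≤ᵇ j≤m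
...   | true | _ = invTab-stable f j≤m

inv1-suc : ∀ f n → inv1 f (suc n) ≡ - (tail f ⊗ inv1 f) n
inv1-suc f n with n ℕ.<ᵇ n | ℕₚ.<ᵇ⇒< n n
... | true  | n<n = ⊥-elim (ℕₚ.n≮n n (n<n _))
... | false | _   =
  cong -_ (sumTo-cong (λ i → cong (f (suc i) ℤ.*_) (invTab-stable f (ℕₚ.m∸n≤m n i))) n)

⊗-inv1 : ∀ f → f 0 ≡ + 1 → f ⊗ inv1 f ≗ one
⊗-inv1 f f₀≡1 zero    rewrite f₀≡1 = refl
⊗-inv1 f f₀≡1 (suc n) = begin
  (f ⊗ inv1 f) (suc n)                            ≡⟨ tail-⊗ f (inv1 f) n ⟩
  f 0 ℤ.* inv1 f (suc n) ℤ.+ (tail f ⊗ inv1 f) n  ≡⟨ cong₂ (λ a b → a ℤ.* b ℤ.+ (tail f ⊗ inv1 f) n)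
                                                             f₀≡1 (inv1-suc f n) ⟩
  + 1 ℤ.* - t ℤ.+ t                               ≡⟨ cong (ℤ._+ t) (ℤₚ.*-identityˡ (- t)) ⟩
  - t ℤ.+ t                                       ≡⟨ ℤₚ.+-inverseˡ t ⟩
  +0                                              ∎
  where
  open ≡-Reasoning
  t : ℤ
  t = (tail f ⊗ inv1 f) n

⊗-cancelˡ : ∀ d e {u v} → d ⊗ e ≗ one → d ⊗ u ≗ d ⊗ v → u ≗ v
⊗-cancelˡ d e {u} {v} de≗1 du≗dv = begin
  u             ≈⟨ PS.*-identityˡ u ⟨
  one ⊗ u       ≈⟨ ⊗-congʳ u ed≗1 ⟨
  (e ⊗ d) ⊗ u   ≈⟨ PS.*-assoc e d u ⟩
  e ⊗ (d ⊗ u)   ≈⟨ ⊗-congˡ e du≗dv ⟩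
  e ⊗ (d ⊗ v)   ≈⟨ PS.*-assoc e d v ⟨
  (e ⊗ d) ⊗ v   ≈⟨ ⊗-congʳ v ed≗1 ⟩
  one ⊗ v       ≈⟨ PS.*-identityˡ v ⟩
  v             ∎
  where
  open ≈-Reasoning
  ed≗1 : e ⊗ d ≗ one
  ed≗1 = PS.trans (⊗-comm e d) de≗1

-- Eliminating the run system

≢⇒≡ᵇ≡false : ∀ {m n} → m ≢ n → (m ≡ᵇ n) ≡ false
≢⇒≡ᵇ≡false {m} {n} m≢n with m ≡ᵇ n | ℕₚ.≡ᵇ⇒≡ m n
... | false | _    = refl
... | true  | m≡n = ⊥-elim (m≢n (m≡n _))

denom-expand : ∀ r → denom r ≗ (((one ⊕ (⊖ (constant (+ 2) ⊗ X))) ⊕ X^ r) ⊕ (⊖ (X ⊗ X^ r)))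
denom-expand r n =
  cong₂ ℤ._+_ (cong (λ t → one n ℤ.+ - t ℤ.+ X^ r n) (sym (constant-⊗ (+ 2) X n)))
              (cong -_ (X^-suc r n))

numer⊗-fixedPoint : ∀ {b s} → b ≗ ((X ⊗ b) ⊕ s) → numer ⊗ b ≗ s
numer⊗-fixedPoint {b} {s} b≗Xb+s = begin
  numer ⊗ b                          ≈⟨ solve 2 (λ x b → (con (+ 1) :- x) :* b := b :- x :* b)
                                               PS.refl X b ⟩
  b ⊕ (⊖ (X ⊗ b))                    ≈⟨ ⊕-congʳ (⊖ (X ⊗ b)) b≗Xb+s ⟩
  ((X ⊗ b) ⊕ s) ⊕ (⊖ (X ⊗ b))        ≈⟨ solve 2 (λ t s → t :+ s :- t := s) PS.refl (X ⊗ b) s ⟩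
  s                                  ∎
  where open ≈-Reasoning

numer⊗-step : ∀ b s → numer ⊗ ((X ⊗ b) ⊕ s) ≗ ((X ⊗ (numer ⊗ b)) ⊕ (numer ⊗ s))
numer⊗-step = solve 3 (λ x b s → (con (+ 1) :- x) :* (x :* b :+ s)
                                 := x :* ((con (+ 1) :- x) :* b) :+ (con (+ 1) :- x) :* s)
                      PS.refl X

-- In the notation of the proof idea: a = a_k, p = a_{k−1}, i = δ_{k0}, and B c as there.
denom⊗-runSystem : ∀ r′ (a p i : PS) (B : ℕ → PS) →
  a ≗ (i ⊕ (X ⊗ B 1)) →
  (∀ c → B c ≗ ((X ⊗ B (suc c)) ⊕ (if c ≡ᵇ suc r′ then p else a))) →
  B (suc (suc (suc r′))) ≗ B (suc (suc r′)) →
  denom (suc r′) ⊗ a ≗ ((numer ⊗ i) ⊕ (X^ (suc r′) ⊗ (numer ⊗ p)))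
denom⊗-runSystem r′ a p i B a≗i+XB₁ B-step B-saturated = begin
  denom r ⊗ a
    ≈⟨ ⊗-congʳ a (denom-expand r) ⟩
  (((one ⊕ (⊖ (constant (+ 2) ⊗ X))) ⊕ X^ r) ⊕ (⊖ (X ⊗ X^ r))) ⊗ a
    ≈⟨ solve 3 (λ x z a → (con (+ 1) :- con (+ 2) :* x :+ z :- x :* z) :* a
                          := (con (+ 1) :- x) :* a :- x :* a :+ z :* ((con (+ 1) :- x) :* a))
               PS.refl X (X^ r) a ⟩
  (((numer ⊗ a) ⊕ (⊖ (X ⊗ a))) ⊕ (X^ r ⊗ (numer ⊗ a)))
    ≈⟨ ⊕-congʳ _ (⊕-congʳ _ (⊗-congˡ numer a≗i+XB₁)) ⟩
  (((numer ⊗ (i ⊕ (X ⊗ B 1))) ⊕ (⊖ (X ⊗ a))) ⊕ (X^ r ⊗ (numer ⊗ a)))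
    ≈⟨ ⊕-congʳ _ (⊕-congʳ _ (PS.trans (PS.distribˡ numer i (X ⊗ B 1))
                                        (⊕-congˡ (numer ⊗ i) (x∙yz≈y∙xz numer X (B 1))))) ⟩
  ((((numer ⊗ i) ⊕ (X ⊗ (numer ⊗ B 1))) ⊕ (⊖ (X ⊗ a))) ⊕ (X^ r ⊗ (numer ⊗ a)))
    ≈⟨ ⊕-congʳ _ (⊕-congʳ _ (⊕-congˡ (numer ⊗ i) (⊗-congˡ X (telescope r′ (ℕₚ.+-comm r′ 1))))) ⟩
  ((((numer ⊗ i) ⊕ (X ⊗ (a ⊕ (X^ r′ ⊗ Q)))) ⊕ (⊖ (X ⊗ a))) ⊕ (X^ r ⊗ (numer ⊗ a)))
    ≈⟨ solve 6 (λ x y z t a q → t :+ x :* (a :+ y :* q) :- x :* a :+ z :* ((con (+ 1) :- x) :* a)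
                              := t :+ (x :* y) :* q :+ z :* ((con (+ 1) :- x) :* a))
               PS.refl X (X^ r′) (X^ r) (numer ⊗ i) a Q ⟩
  (((numer ⊗ i) ⊕ ((X ⊗ X^ r′) ⊗ Q)) ⊕ (X^ r ⊗ (numer ⊗ a)))
    ≈⟨ ⊕-congʳ _ (⊕-congˡ (numer ⊗ i) (⊗-congʳ Q (X^-suc r′))) ⟨
  (((numer ⊗ i) ⊕ (X^ r ⊗ Q)) ⊕ (X^ r ⊗ (numer ⊗ a)))
    ≈⟨ solve 5 (λ x z t p a → t :+ z :* ((con (+ 1) :- x) :* (p :- a))
                                :+ z :* ((con (+ 1) :- x) :* a)
                            := t :+ z :* ((con (+ 1) :- x) :* p))
               PS.refl X (X^ r) (numer ⊗ i) p a ⟩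
  ((numer ⊗ i) ⊕ (X^ r ⊗ (numer ⊗ p)))
    ∎
  where
  open ≈-Reasoning
  r : ℕ
  r = suc r′

  Q : PS
  Q = numer ⊗ (p ⊕ (⊖ a))

  step-other : ∀ c → c ≢ r → B c ≗ ((X ⊗ B (suc c)) ⊕ a)
  step-other c c≢r =
    subst (λ d → B c ≗ ((X ⊗ B (suc c)) ⊕ (if d then p else a))) (≢⇒≡ᵇ≡false c≢r) (B-step c)

  step-closing : B r ≗ ((X ⊗ B (suc r)) ⊕ p)
  step-closing with r ≡ᵇ r | ℕₚ.≡⇒≡ᵇ r r refl | B-step r
  ... | true | _ | eq = eq

  saturated : numer ⊗ B (suc r) ≗ a
  saturated = numer⊗-fixedPoint
    (PS.trans (step-other (suc r) ℕₚ.1+n≢n) (⊕-congʳ a (⊗-congˡ X B-saturated)))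

  telescope : ∀ d {c} → d ℕ.+ c ≡ r → numer ⊗ B c ≗ (a ⊕ (X^ d ⊗ Q))
  telescope zero refl = begin
    numer ⊗ B r                               ≈⟨ ⊗-congˡ numer step-closing ⟩
    numer ⊗ ((X ⊗ B (suc r)) ⊕ p)             ≈⟨ numer⊗-step (B (suc r)) p ⟩
    (X ⊗ (numer ⊗ B (suc r))) ⊕ (numer ⊗ p)   ≈⟨ ⊕-congʳ (numer ⊗ p) (⊗-congˡ X saturated) ⟩
    (X ⊗ a) ⊕ (numer ⊗ p)
      ≈⟨ solve 3 (λ x a p → x :* a :+ (con (+ 1) :- x) :* p
                            := a :+ con (+ 1) :* ((con (+ 1) :- x) :* (p :- a)))
                 PS.refl X a p ⟩
    a ⊕ (one ⊗ Q)                             ∎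
  telescope (suc d) {c} d+1+c≡r = begin
    numer ⊗ B c                               ≈⟨ ⊗-congˡ numer (step-other c c≢r) ⟩
    numer ⊗ ((X ⊗ B (suc c)) ⊕ a)             ≈⟨ numer⊗-step (B (suc c)) a ⟩
    (X ⊗ (numer ⊗ B (suc c))) ⊕ (numer ⊗ a)   ≈⟨ ⊕-congʳ (numer ⊗ a) (⊗-congˡ X
                                                   (telescope d (trans (ℕₚ.+-suc d c) d+1+c≡r))) ⟩
    (X ⊗ (a ⊕ (X^ d ⊗ Q))) ⊕ (numer ⊗ a)
      ≈⟨ solve 4 (λ x w a q → x :* (a :+ w :* q) :+ (con (+ 1) :- x) :* a := a :+ (x :* w) :* q)
                 PS.refl X (X^ d) a Q ⟩
    a ⊕ ((X ⊗ X^ d) ⊗ Q)                      ≈⟨ ⊕-congˡ a (⊗-congʳ Q (X^-suc d)) ⟨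
    a ⊕ (X^ (suc d) ⊗ Q)                      ∎
    where
    c≢r : c ≢ r
    c≢r c≡r = ℕₚ.m≢1+n+m c (trans c≡r (sym d+1+c≡r))

-- Counting words by their runs

count : {A : Set} → (A → Bool) → List A → ℕ
count p []       = 0
count p (x ∷ xs) = if p x then suc (count p xs) else count p xs

length-filterᵇ : ∀ {A : Set} (p : A → Bool) xs → length (filterᵇ p xs) ≡ count p xs
length-filterᵇ p []       = refl
length-filterᵇ p (x ∷ xs) with p x
... | true  = cong suc (length-filterᵇ p xs)
... | false = length-filterᵇ p xs

count-++ : ∀ {A : Set} (p : A → Bool) xs ys → count p (xs ++ ys) ≡ count p xs ℕ.+ count p ys
count-++ p []       ys = refl
count-++ p (x ∷ xs) ys with p x
... | true  = cong suc (count-++ p xs ys)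
... | false = count-++ p xs ys

count-map : ∀ {A B : Set} (p : B → Bool) (f : A → B) xs → count p (map f xs) ≡ count (p ∘ f) xs
count-map p f []       = refl
count-map p f (x ∷ xs) with p (f x)
... | true  = cong suc (count-map p f xs)
... | false = count-map p f xs

count-cong : ∀ {A : Set} {p q : A → Bool} → p ≗ q → count p ≗ count q
count-cong p≗q []       = refl
count-cong {p = p} {q} p≗q (x ∷ xs) with p x | q x | p≗q x
... | true  | true  | _ = cong suc (count-cong p≗q xs)
... | false | false | _ = count-cong p≗q xs

count-false : ∀ {A : Set} (xs : List A) → count (λ _ → false) xs ≡ 0
count-false []       = refl
count-false (x ∷ xs) = count-false xs

wordCount : (List Bool → Bool) → ℕ → ℕ
wordCount p n = count p (words n)

wordCount-suc : ∀ p n →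
  wordCount p (suc n) ≡ wordCount (p ∘ (false ∷_)) n ℕ.+ wordCount (p ∘ (true ∷_)) n
wordCount-suc p n =
  trans (count-++ p (map (false ∷_) (words n)) (map (true ∷_) (words n)))
        (cong₂ ℕ._+_ (count-map p (false ∷_) (words n)) (count-map p (true ∷_) (words n)))

δ₀ : ℕ → ℕ
δ₀ zero    = 1
δ₀ (suc _) = 0

-- If g counts objects by some statistic, shiftIf true g counts them by that statistic plus one.
shiftIf : Bool → (ℕ → ℕ) → ℕ → ℕ
shiftIf false g k       = g k
shiftIf true  g zero    = 0
shiftIf true  g (suc k) = g k

shiftIf-cong : ∀ d {g h} → g ≗ h → shiftIf d g ≗ shiftIf d h
shiftIf-cong false g≗h k       = g≗h k
shiftIf-cong true  g≗h zero    = refl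
shiftIf-cong true  g≗h (suc k) = g≗h k

wordCount-shiftIf : ∀ d (g : List Bool → ℕ) n k →
  wordCount (λ w → (if d then suc (g w) else g w) ≡ᵇ k) n
    ≡ shiftIf d (λ j → wordCount (λ w → g w ≡ᵇ j) n) k
wordCount-shiftIf false g n k       = refl
wordCount-shiftIf true  g n zero    = count-false (words n)
wordCount-shiftIf true  g n (suc k) = refl

-- completions r c n k counts the words w of length n such that, appended to a run of length c,
-- w produces exactly k maximal runs of length r (the initial run included).
completions : ℕ → ℕ → ℕ → ℕ → ℕ
completions r c zero    = shiftIf (c ≡ᵇ r) δ₀
completions r c (suc n) k = completions r (suc c) n k ℕ.+ shiftIf (c ≡ᵇ r) (completions r 1 n) k

wordCount-runsFrom : ∀ r b c n k →
  wordCount (λ w → count (_≡ᵇ r) (runsFrom b c w) ≡ᵇ k) n ≡ completions r c n k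

wordCount-closedRun : ∀ r b c n k →
  wordCount (λ w → count (_≡ᵇ r) (c ∷ runsFrom b 1 w) ≡ᵇ k) n
    ≡ shiftIf (c ≡ᵇ r) (completions r 1 n) k
wordCount-closedRun r b c n k =
  trans (wordCount-shiftIf (c ≡ᵇ r) (count (_≡ᵇ r) ∘ runsFrom b 1) n k)
        (shiftIf-cong (c ≡ᵇ r) (wordCount-runsFrom r b 1 n) k)

wordCount-runsFrom r b c zero k =
  trans (wordCount-shiftIf (c ≡ᵇ r) (λ _ → 0) 0 k) (shiftIf-cong (c ≡ᵇ r) δ₀-words k)
  where
  δ₀-words : ∀ j → wordCount (λ _ → 0 ≡ᵇ j) 0 ≡ δ₀ j
  δ₀-words zero    = refl
  δ₀-words (suc j) = refl
wordCount-runsFrom r false c (suc n) k = trans (wordCount-suc _ n)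
  (cong₂ ℕ._+_ (wordCount-runsFrom r false (suc c) n k) (wordCount-closedRun r true c n k))
wordCount-runsFrom r true c (suc n) k = trans (wordCount-suc _ n)
  (trans (cong₂ ℕ._+_ (wordCount-closedRun r false c n k) (wordCount-runsFrom r true (suc c) n k))
         (ℕₚ.+-comm (shiftIf (c ≡ᵇ r) (completions r 1 n) k) _))

N-zero : ∀ r k → N 0 r k ≡ δ₀ k
N-zero r zero    = refl
N-zero r (suc k) = refl

N-suc : ∀ r n k → N (suc n) r k ≡ completions r 1 n k
N-suc r n k = begin
  N (suc n) r k
    ≡⟨ length-filterᵇ _ (words (suc n)) ⟩
  wordCount (λ w → beginsWith0 w ∧ (runsOfLength r w ≡ᵇ k)) (suc n)
    ≡⟨ wordCount-suc _ n ⟩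
  wordCount (λ w → runsOfLength r (false ∷ w) ≡ᵇ k) n ℕ.+ wordCount (λ _ → false) n
    ≡⟨ cong₂ ℕ._+_
         (count-cong (λ w → cong (_≡ᵇ k) (length-filterᵇ _ (runsFrom false 1 w))) (words n))
         (count-false (words n)) ⟩
  wordCount (λ w → count (_≡ᵇ r) (runsFrom false 1 w) ≡ᵇ k) n ℕ.+ 0
    ≡⟨ ℕₚ.+-identityʳ _ ⟩
  wordCount (λ w → count (_≡ᵇ r) (runsFrom false 1 w) ≡ᵇ k) n
    ≡⟨ wordCount-runsFrom r false 1 n k ⟩
  completions r 1 n k ∎
  where open ≡-Reasoning

-- Once the current run is longer than r it can never again count, whatever its length.
completions-saturated : ∀ r {c c′} → r ℕ.< c → r ℕ.< c′ →
  ∀ n k → completions r c n k ≡ completions r c′ n k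
completions-saturated r {c} {c′} r<c r<c′ zero k
  rewrite ≢⇒≡ᵇ≡false (ℕₚ.>⇒≢ r<c) | ≢⇒≡ᵇ≡false (ℕₚ.>⇒≢ r<c′) = refl
completions-saturated r {c} {c′} r<c r<c′ (suc n) k
  rewrite ≢⇒≡ᵇ≡false (ℕₚ.>⇒≢ r<c) | ≢⇒≡ᵇ≡false (ℕₚ.>⇒≢ r<c′) =
  cong (ℕ._+ completions r 1 n k)
       (completions-saturated r (ℕₚ.m<n⇒m<1+n r<c) (ℕₚ.m<n⇒m<1+n r<c′) n k)

-- The generating functions

completionsGF : ℕ → ℕ → ℕ → PS
completionsGF r k c n = + completions r c n k

initialGF : ℕ → PS
initialGF zero    = one
initialGF (suc k) = 0ₚ

prevGF : ℕ → ℕ → PS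
prevGF r zero    = 0ₚ
prevGF r (suc k) = GF r k

GF-decompose : ∀ r k → GF r k ≗ (initialGF k ⊕ (X ⊗ completionsGF r k 1))
GF-decompose r k =
  PS.trans (coefficients k) (⊕-congˡ (initialGF k) (PS.sym (X⊗-shift (completionsGF r k 1))))
  where
  coefficients : ∀ k → GF r k ≗ (initialGF k ⊕ shift (completionsGF r k 1))
  coefficients zero    zero    = refl
  coefficients (suc _) zero    = refl
  coefficients zero    (suc n) = cong +_ (N-suc r n 0)
  coefficients (suc k) (suc n) = cong +_ (N-suc r n (suc k))

completionsGF-step : ∀ r k c →
  completionsGF r k c ≗ ((X ⊗ completionsGF r k (suc c)) ⊕ (if c ≡ᵇ r then prevGF r k else GF r k))
completionsGF-step r k c n =
  trans (coefficients n)
        (cong (ℤ._+ closing (c ≡ᵇ r) n) (sym (X⊗-shift (completionsGF r k (suc c)) n)))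
  where
  closing : Bool → PS
  closing d = if d then prevGF r k else GF r k
  closing-coefficient : ∀ d n → + shiftIf d (λ j → N n r j) k ≡ closing d n
  closing-coefficient false n = refl
  closing-coefficient true  n = prev-coefficient k
    where
    prev-coefficient : ∀ k → + shiftIf true (λ j → N n r j) k ≡ prevGF r k n
    prev-coefficient zero    = refl
    prev-coefficient (suc _) = refl
  coefficients : ∀ n →
    completionsGF r k c n ≡ shift (completionsGF r k (suc c)) n ℤ.+ closing (c ≡ᵇ r) n
  coefficients zero = begin
    + shiftIf (c ≡ᵇ r) δ₀ k                ≡⟨ cong +_ (shiftIf-cong (c ≡ᵇ r) (sym ∘ N-zero r) k) ⟩
    + shiftIf (c ≡ᵇ r) (λ j → N 0 r j) k   ≡⟨ closing-coefficient (c ≡ᵇ r) 0 ⟩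
    closing (c ≡ᵇ r) 0                     ≡⟨ ℤₚ.+-identityˡ _ ⟨
    +0 ℤ.+ closing (c ≡ᵇ r) 0              ∎
    where open ≡-Reasoning
  coefficients (suc n) = begin
    + (completions r (suc c) n k ℕ.+ shiftIf (c ≡ᵇ r) (completions r 1 n) k)
      ≡⟨ ℤₚ.pos-+ (completions r (suc c) n k) _ ⟩
    + completions r (suc c) n k ℤ.+ + shiftIf (c ≡ᵇ r) (completions r 1 n) k
      ≡⟨ cong (λ t → + completions r (suc c) n k ℤ.+ + t)
              (shiftIf-cong (c ≡ᵇ r) (sym ∘ N-suc r n) k) ⟩
    + completions r (suc c) n k ℤ.+ + shiftIf (c ≡ᵇ r) (λ j → N (suc n) r j) k
      ≡⟨ cong (ℤ._+_ (+ completions r (suc c) n k)) (closing-coefficient (c ≡ᵇ r) (suc n)) ⟩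
    + completions r (suc c) n k ℤ.+ closing (c ≡ᵇ r) (suc n) ∎
    where open ≡-Reasoning

denom⊗GF : ∀ r′ k →
  denom (suc r′) ⊗ GF (suc r′) k
    ≗ ((numer ⊗ initialGF k) ⊕ (X^ (suc r′) ⊗ (numer ⊗ prevGF (suc r′) k)))
denom⊗GF r′ k = denom⊗-runSystem r′ (GF r k) (prevGF r k) (initialGF k) (completionsGF r k)
  (GF-decompose r k)
  (completionsGF-step r k)
  (λ n → cong +_ (completions-saturated r (ℕₚ.m<n⇒m<1+n (ℕₚ.n<1+n r)) (ℕₚ.n<1+n r) n k))
  where
  r : ℕ
  r = suc r′

denom⊗GF-zero : ∀ r′ → denom (suc r′) ⊗ GF (suc r′) 0 ≗ numer
denom⊗GF-zero r′ = begin
  denom r ⊗ GF r 0                        ≈⟨ denom⊗GF r′ 0 ⟩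
  (numer ⊗ one) ⊕ (X^ r ⊗ (numer ⊗ 0ₚ))   ≈⟨ PS.+-cong (PS.*-identityʳ numer)
                                               (PS.trans (⊗-congˡ (X^ r) (PS.zeroʳ numer))
                                                         (PS.zeroʳ (X^ r))) ⟩
  numer ⊕ 0ₚ                              ≈⟨ PS.+-identityʳ numer ⟩
  numer                                   ∎
  where
  open ≈-Reasoning
  r : ℕ
  r = suc r′

denom⊗GF-suc : ∀ r′ k →
  denom (suc r′) ⊗ GF (suc r′) (suc k) ≗ (X^ (suc r′) ⊗ (numer ⊗ GF (suc r′) k))
denom⊗GF-suc r′ k = begin
  denom r ⊗ GF r (suc k)                         ≈⟨ denom⊗GF r′ (suc k) ⟩
  (numer ⊗ 0ₚ) ⊕ (X^ r ⊗ (numer ⊗ GF r k))       ≈⟨ ⊕-congʳ _ (PS.zeroʳ numer) ⟩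
  0ₚ ⊕ (X^ r ⊗ (numer ⊗ GF r k))                 ≈⟨ PS.+-identityˡ _ ⟩
  X^ r ⊗ (numer ⊗ GF r k)                        ∎
  where
  open ≈-Reasoning
  r : ℕ
  r = suc r′

denom⊗inv : ∀ r′ → denom (suc r′) ⊗ inv1 (denom (suc r′)) ≗ one
denom⊗inv r′ = ⊗-inv1 (denom (suc r′)) refl

denom⊗RHS-zero : ∀ r′ → denom (suc r′) ⊗ RHS (suc r′) 0 ≗ numer
denom⊗RHS-zero r′ = begin
  denom r ⊗ (one ⊗ ((numer ⊗ I) ⊗ one))
    ≈⟨ solve 3 (λ d n e → d :* (con (+ 1) :* ((n :* e) :* con (+ 1))) := n :* (d :* e))
               PS.refl (denom r) numer I ⟩
  numer ⊗ (denom r ⊗ I)                  ≈⟨ ⊗-congˡ numer (denom⊗inv r′) ⟩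
  numer ⊗ one                            ≈⟨ PS.*-identityʳ numer ⟩
  numer                                  ∎
  where
  open ≈-Reasoning
  r : ℕ
  r = suc r′
  I : PS
  I = inv1 (denom r)

denom⊗RHS-suc : ∀ r′ k →
  denom (suc r′) ⊗ RHS (suc r′) (suc k) ≗ (X^ (suc r′) ⊗ (numer ⊗ RHS (suc r′) k))
denom⊗RHS-suc r′ k = begin
  denom r ⊗ (X^ (r ℕ.+ k ℕ.* r) ⊗ ((numer ⊗ I) ⊗ G))
    ≈⟨ ⊗-congˡ (denom r) (⊗-congʳ ((numer ⊗ I) ⊗ G) (X^-+ r (k ℕ.* r))) ⟩
  denom r ⊗ ((X^ r ⊗ X^ (k ℕ.* r)) ⊗ ((numer ⊗ I) ⊗ G))
    ≈⟨ solve 6 (λ d z v n e g → d :* ((z :* v) :* ((n :* e) :* g))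
                                := (d :* e) :* (z :* (n :* (v :* g))))
               PS.refl (denom r) (X^ r) (X^ (k ℕ.* r)) numer I G ⟩
  (denom r ⊗ I) ⊗ (X^ r ⊗ (numer ⊗ (X^ (k ℕ.* r) ⊗ G)))
    ≈⟨ ⊗-congʳ (X^ r ⊗ (numer ⊗ (X^ (k ℕ.* r) ⊗ G))) (denom⊗inv r′) ⟩
  one ⊗ (X^ r ⊗ (numer ⊗ (X^ (k ℕ.* r) ⊗ G)))
    ≈⟨ PS.*-identityˡ _ ⟩
  X^ r ⊗ (numer ⊗ (X^ (k ℕ.* r) ⊗ G))
    ∎
  where
  open ≈-Reasoning
  r : ℕ
  r = suc r′
  I : PS
  I = inv1 (denom r)
  G : PS
  G = (numer ⊗ I) ^ps suc k

denom-cancelˡ : ∀ r′ {u v} → denom (suc r′) ⊗ u ≗ denom (suc r′) ⊗ v → u ≗ v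
denom-cancelˡ r′ = ⊗-cancelˡ (denom (suc r′)) (inv1 (denom (suc r′))) (denom⊗inv r′)

mainTheorem1 : (r k : ℕ) → 1 ≤ r → (n : ℕ) → GF r k n ≡ RHS r k n
mainTheorem1 zero     k       ()
mainTheorem1 (suc r′) zero    _   =
  denom-cancelˡ r′ (PS.trans (denom⊗GF-zero r′) (PS.sym (denom⊗RHS-zero r′)))
mainTheorem1 (suc r′) (suc k) 1≤r = denom-cancelˡ r′ (begin
  denom r ⊗ GF r (suc k)        ≈⟨ denom⊗GF-suc r′ k ⟩
  X^ r ⊗ (numer ⊗ GF r k)       ≈⟨ ⊗-congˡ (X^ r) (⊗-congˡ numer (mainTheorem1 r k 1≤r)) ⟩
  X^ r ⊗ (numer ⊗ RHS r k)      ≈⟨ denom⊗RHS-suc r′ k ⟨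
  denom r ⊗ RHS r (suc k)       ∎)
  where
  open ≈-Reasoning
  r : ℕ
  r = suc r′
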